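{- Let $n\ge 1$ and $20n\le m<2^{n/2}$ be integers. Any $\mathsf{PostBPP}$ communication protocol that solves $\textsc{XOR-Missing-String}(n,m)$ with error at most $2^{ -5n}$ has communication complexity $\Omega(m)$. That is, there is an absolute constant $c>0$ such that its complexity is at least $cm$.
   Context: $\textsc{XOR-Missing-String}(n,m)$, for $m<2^{n/2}$, is the following problem. Alice receives $X=(x_1,\dots,x_m)$ and Bob receives $Y=(y_1,\dots,y_m)$, with all $x_i,y_j\in\{0,1\}^n$. A string $s\in\{0,1\}^n$ is a solution on input $(X,Y)$ if $s\ne x_i\oplus y_j$ for all $i,j\in[m]$, where $\oplus$ is bitwise XOR. A $\mathsf{PostBPP}$ communication protocol $\Pi$ for a search problem $f$ on $\mathcal{X}\times\mathcal{Y}$ with range $\mathcal{O}$ is given by a length $k$ and a family $\{\Pi_r\}_{r\in\{0,1\}^k}$ of deterministic communication protocols, each of communication complexity $c$. Each $\Pi_r$ outputs either $\bot$ or an element of $\mathcal{O}$. On input $(X,Y)$, the protocol draws a uniform public random $r$ and runs $\Pi_r$. Its complexity is $k+c$. The protocol solves $f$ with error $\epsilon$ if for every input $(X,Y)$, \[ \Pr_r\big[\Pi_r(X,Y)\text{ is a solution to }f(X,Y)\,\big|\,\Pi_r(X,Y)\ne\bot\big]\ge 1-\epsilon. \] -}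

module Defs where

open import Data.Nat using (ℕ; zero; suc; _+_; _*_; _∸_; _^_; _≤_; _<_; _⊔_)
open import Data.Bool using (Bool; true; false; if_then_else_; _xor_)
open import Data.Bool.Properties renaming (_≟_ to _≟B_)
open import Data.Maybe using (Maybe; just; nothing)
open import Data.Vec using (Vec; []; _∷_; zipWith; lookup)
open import Data.Vec.Properties using (≡-dec)
open import Data.Fin using (Fin)
open import Data.Fin.Properties using (all?)
open import Data.Product using (_×_)
open import Function using (_∘_)
open import Relation.Nullary using (¬_; Dec; yes; no)
open import Relation.Nullary.Decidable using (⌊_⌋; ¬?)
open import Relation.Binary.PropositionalEquality using (_≡_)

BitStr : ℕ → Set
BitStr n = Vec Bool n

_⊕_ : ∀ {n} → BitStr n → BitStr n → BitStr n
_⊕_ = zipWith _xor_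

data Protocol (X Y O : Set) : Set where
  leaf  : O → Protocol X Y O
  alice : (X → Bool) → Protocol X Y O → Protocol X Y O → Protocol X Y O
  bob   : (Y → Bool) → Protocol X Y O → Protocol X Y O → Protocol X Y O

run : ∀ {X Y O} → Protocol X Y O → X → Y → O
run (leaf o)      x y = o
run (alice f l r) x y = if f x then run l x y else run r x y
run (bob g l r)   x y = if g y then run l x y else run r x y

-- communication complexity of a protocol tree = its depth
depth : ∀ {X Y O} → Protocol X Y O → ℕ
depth (leaf _)      = 0
depth (alice _ l r) = suc (depth l ⊔ depth r)
depth (bob _ l r)   = suc (depth l ⊔ depth r)

count : ∀ k → (Vec Bool k → Bool) → ℕ
count zero    p = if p [] then 1 else 0
count (suc k) p = count k (p ∘ (true ∷_)) + count k (p ∘ (false ∷_))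

IsSolution : ∀ {n m} → Vec (BitStr n) m → Vec (BitStr n) m → BitStr n → Set
IsSolution X Y s = ∀ i j → ¬ (s ≡ (lookup X i ⊕ lookup Y j))

isSolution? : ∀ {n m} (X Y : Vec (BitStr n) m) (s : BitStr n) → Dec (IsSolution X Y s)
isSolution? X Y s =
  all? λ i → all? λ j → ¬? (≡-dec _≟B_ s (lookup X i ⊕ lookup Y j))

Input : ℕ → ℕ → Set
Input n m = Vec (BitStr n) m

-- a PostBPP protocol: family of deterministic protocols indexed by r ∈ {0,1}^k,
-- outputting nothing (= ⊥) or a string
PostProtocol : ℕ → ℕ → ℕ → Set
PostProtocol n m k = Vec Bool k → Protocol (Input n m) (Input n m) (Maybe (BitStr n))

notBot : ∀ {n} → Maybe (BitStr n) → Bool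
notBot (just _) = true
notBot nothing  = false

goodOut : ∀ {n m} → Input n m → Input n m → Maybe (BitStr n) → Bool
goodOut X Y (just s) = ⌊ isSolution? X Y s ⌋
goodOut X Y nothing  = false

-- Π solves XOR-Missing-String(n,m) with error ε = 1/2^e, e ≥ 0:
-- for every input, Pr_r[Π_r ≠ ⊥] > 0 (so the conditional probability is defined) and
-- Pr_r[good | ≠ ⊥] ≥ 1 - 2^{-e}, i.e. 2^e · #good ≥ (2^e - 1) · #nonbot.
SolvesWithError : ∀ {n m k} → PostProtocol n m k → (e : ℕ) → Set
SolvesWithError {n} {m} {k} Π e = ∀ (X Y : Input n m) →
  (0 < count k (λ r → notBot (run (Π r) X Y))) ×
  ((2 ^ e ∸ 1) * count k (λ r → notBot (run (Π r) X Y))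
     ≤ 2 ^ e * count k (λ r → goodOut X Y (run (Π r) X Y)))

-- Let N = 2^n. Call v heavy at coordinate i for a set A of inputs if at least |A|/N² members
-- of A have v there. Since 2m ≤ N, the members of A with some light coordinate make up at
-- most half of A, so |A| ≤ 2 ∏ᵢ #(heavy values at i). On a rectangle A × B with output s:
-- if some v heavy for A and w heavy for B have v ⊕ w = s, the two fibres give at least
-- |A||B|/N⁴ pairs on which s is wrong; otherwise the values heavy for A and the values
-- heavy for B shifted by s are disjoint subsets of {0,1}^n, and AM-GM gives
-- 4^m |A||B| ≤ 4 N^{2m}. Each Π_r cuts the inputs into at most 2^c rectangles, so summing
-- over inputs and random strings, 4^m·#nonBot ≤ 4^m N⁴·#wrong + 2^{k+c}·4N^{2m}. The error
-- 2^{-5n} = 1/(N·N⁴) gives N·N⁴·#wrong ≤ #nonBot, which absorbs the first term, and every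
-- input has a non-⊥ run, so #nonBot ≥ N^{2m}. Hence 4^m ≤ 2^{k+c+3}, i.e. 2m ≤ k + c + 3.

module Submission where

open import Defs
open import Data.Bool using (Bool; true; false; not; _∧_; _xor_; T)
open import Data.Bool.Properties using (xor-assoc; xor-same; T-≡; ∧-conicalˡ; ∧-conicalʳ) renaming (_≟_ to _≟B_)
open import Data.Fin using (Fin; zero; suc)
open import Data.Maybe using (Maybe; just; nothing)
open import Data.Nat using (ℕ; zero; suc; _+_; _*_; _^_; _∸_; _⊔_; _≤_; _<_; _≤ᵇ_; z≤n; s≤s; NonZero; >-nonZero)
open import Data.Nat.Properties hiding (_≟_)
open import Algebra.Properties.CommutativeSemigroup +-commutativeSemigroup using (interchange)
open import Data.Nat.Tactic.RingSolver using (solve-∀)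
open import Data.Product using (Σ; ∃; _×_; _,_; proj₁; proj₂)
open import Data.Sum using ([_,_]′)
open import Data.Vec using (Vec; []; _∷_; lookup; zipWith)
open import Data.Vec.Properties using (≡-dec)
open import Function using (_∘_; Equivalence)
open import Relation.Binary.Definitions using (DecidableEquality)
open import Relation.Binary.PropositionalEquality
open import Relation.Nullary using (¬_; does; yes; no; contradiction)
open import Relation.Nullary.Decidable using (⌊_⌋; dec-false; isYes≗does)

-- Arithmetic

^-distrib-* : ∀ a b m → (a * b) ^ m ≡ a ^ m * b ^ m
^-distrib-* a b zero    = refl
^-distrib-* a b (suc m) = trans (cong (a * b *_) (^-distrib-* a b m)) (swap a b (a ^ m) (b ^ m))
  where
  swap : ∀ a b c d → a * b * (c * d) ≡ a * c * (b * d)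
  swap = solve-∀

4xy≤[x+y]² : ∀ x y → 4 * (x * y) ≤ (x + y) * (x + y)
4xy≤[x+y]² x y = [ ordered , swapped ]′ (≤-total x y)
  where
  expand : ∀ x d → 4 * (x * (x + d)) + d * d ≡ (x + (x + d)) * (x + (x + d))
  expand = solve-∀
  ordered : ∀ {x y} → x ≤ y → 4 * (x * y) ≤ (x + y) * (x + y)
  ordered {x} x≤y with m≤n⇒∃[o]m+o≡n x≤y
  ... | d , refl = subst (4 * (x * (x + d)) ≤_) (expand x d) (m≤m+n _ (d * d))
  swapped : y ≤ x → 4 * (x * y) ≤ (x + y) * (x + y)
  swapped y≤x = subst₂ _≤_ (cong (4 *_) (*-comm y x)) (cong (λ z → z * z) (+-comm y x)) (ordered y≤x)

≤-halve : ∀ N {a p ℓ m} .{{_ : NonZero N}} → 2 * m ≤ N →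
          a ≤ p + ℓ → N * N * ℓ ≤ m * (N * a) → a ≤ 2 * p
≤-halve N {a} {p} {ℓ} {m} 2m≤N a≤p+ℓ N²ℓ≤mNa =
  *-cancelˡ-≤ (N * N) {{m*n≢0 N N}} (+-cancelʳ-≤ (N * N * a) _ _ doubled)
  where
  open ≤-Reasoning
  N²a≤ : N * N * a ≤ N * N * p + m * (N * a)
  N²a≤ = begin
      N * N * a              ≤⟨ *-monoʳ-≤ (N * N) a≤p+ℓ ⟩
      N * N * (p + ℓ)        ≡⟨ *-distribˡ-+ (N * N) p ℓ ⟩
      N * N * p + N * N * ℓ  ≤⟨ +-monoʳ-≤ (N * N * p) N²ℓ≤mNa ⟩
      N * N * p + m * (N * a) ∎
  double : ∀ x p m b → (x * p + m * b) + (x * p + m * b) ≡ x * (2 * p) + (2 * m) * b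
  double = solve-∀
  doubled : N * N * a + N * N * a ≤ N * N * (2 * p) + N * N * a
  doubled = begin
      N * N * a + N * N * a                ≤⟨ +-mono-≤ N²a≤ N²a≤ ⟩
      (N * N * p + m * (N * a)) + (N * N * p + m * (N * a))
                                           ≡⟨ double (N * N) p m (N * a) ⟩
      N * N * (2 * p) + (2 * m) * (N * a)  ≤⟨ +-monoʳ-≤ (N * N * (2 * p)) (*-monoˡ-≤ (N * a) 2m≤N) ⟩
      N * N * (2 * p) + N * (N * a)        ≡⟨ cong (N * N * (2 * p) +_) (*-assoc N N a) ⟨
      N * N * (2 * p) + N * N * a          ∎

≤-absorb : ∀ N {x y L} → 2 ≤ N → N * y ≤ x → x ≤ y + L → x ≤ 2 * L
≤-absorb (suc zero) (s≤s ())
≤-absorb N@(suc M@(suc _)) {x} {y} {L} _ Ny≤x x≤y+L = *-cancelˡ-≤ M (begin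
    M * x            ≤⟨ +-cancelˡ-≤ x _ _ Nx≤x+NL ⟩
    L + M * L        ≤⟨ +-monoˡ-≤ (M * L) (m≤n*m L M) ⟩
    M * L + M * L    ≡⟨ twice M L ⟩
    M * (2 * L)      ∎)
  where
  open ≤-Reasoning
  twice : ∀ M L → M * L + M * L ≡ M * (2 * L)
  twice = solve-∀
  Nx≤x+NL : N * x ≤ x + N * L
  Nx≤x+NL = begin
    N * x            ≤⟨ *-monoʳ-≤ N x≤y+L ⟩
    N * (y + L)      ≡⟨ *-distribˡ-+ N y L ⟩
    N * y + N * L    ≤⟨ +-monoˡ-≤ (N * L) Ny≤x ⟩
    x + N * L        ∎

postselection-error : ∀ {E g w} → 1 ≤ E → (E ∸ 1) * (g + w) ≤ E * g → E * w ≤ g + w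
postselection-error {E} {g} {w} 1≤E error-bound = +-cancelˡ-≤ (E * g) _ _ (begin
    E * g + E * w               ≡⟨ *-distribˡ-+ E g w ⟨
    E * (g + w)                 ≡⟨ cong (_* (g + w)) (m∸n+n≡m 1≤E) ⟨
    (E ∸ 1 + 1) * (g + w)       ≡⟨ *-distribʳ-+ (g + w) (E ∸ 1) 1 ⟩
    (E ∸ 1) * (g + w) + 1 * (g + w) ≤⟨ +-mono-≤ error-bound (≤-reflexive (*-identityˡ (g + w))) ⟩
    E * g + (g + w)             ∎)
  where open ≤-Reasoning

merge-bounds : ∀ a b {g₁ g₂ h₁ h₂ K} d₁ d₂ →
               a * g₁ ≤ b * h₁ + 2 ^ d₁ * K → a * g₂ ≤ b * h₂ + 2 ^ d₂ * K →
               a * (g₁ + g₂) ≤ b * (h₁ + h₂) + 2 ^ suc (d₁ ⊔ d₂) * K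
merge-bounds a b {g₁} {g₂} {h₁} {h₂} {K} d₁ d₂ bound₁ bound₂ = begin
    a * (g₁ + g₂)                                ≡⟨ *-distribˡ-+ a g₁ g₂ ⟩
    a * g₁ + a * g₂                              ≤⟨ +-mono-≤ bound₁ bound₂ ⟩
    (b * h₁ + 2 ^ d₁ * K) + (b * h₂ + 2 ^ d₂ * K) ≡⟨ regroup b h₁ h₂ (2 ^ d₁) (2 ^ d₂) K ⟩
    b * (h₁ + h₂) + (2 ^ d₁ + 2 ^ d₂) * K        ≤⟨ +-monoʳ-≤ (b * (h₁ + h₂)) (*-monoˡ-≤ K 2ᵈ¹+2ᵈ²≤) ⟩
    b * (h₁ + h₂) + 2 ^ suc (d₁ ⊔ d₂) * K        ∎
  where
  open ≤-Reasoning
  2ᵈ¹+2ᵈ²≤ : 2 ^ d₁ + 2 ^ d₂ ≤ 2 ^ suc (d₁ ⊔ d₂)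
  2ᵈ¹+2ᵈ²≤ = begin
    2 ^ d₁ + 2 ^ d₂                  ≤⟨ +-mono-≤ (^-monoʳ-≤ 2 (m≤m⊔n d₁ d₂)) (^-monoʳ-≤ 2 (m≤n⊔m d₁ d₂)) ⟩
    2 ^ (d₁ ⊔ d₂) + 2 ^ (d₁ ⊔ d₂)    ≡⟨ cong (2 ^ (d₁ ⊔ d₂) +_) (+-identityʳ (2 ^ (d₁ ⊔ d₂))) ⟨
    2 ^ suc (d₁ ⊔ d₂)                ∎
  regroup : ∀ b h₁ h₂ x y K → (b * h₁ + x * K) + (b * h₂ + y * K) ≡ b * (h₁ + h₂) + (x + y) * K
  regroup = solve-∀

2^m≤2^n⇒m≤n : ∀ {m n} → 2 ^ m ≤ 2 ^ n → m ≤ n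
2^m≤2^n⇒m≤n 2^m≤2^n = ≮⇒≥ (λ n<m → <⇒≱ (^-monoʳ-< 2 (s≤s (s≤s z≤n)) n<m) 2^m≤2^n)

-- Indicators and finite sums

⟦_⟧ : Bool → ℕ
⟦ true ⟧  = 1
⟦ false ⟧ = 0

⟦∧⟧ : ∀ a b → ⟦ a ∧ b ⟧ ≡ ⟦ a ⟧ * ⟦ b ⟧
⟦∧⟧ true  b = sym (+-identityʳ ⟦ b ⟧)
⟦∧⟧ false b = refl

⟦⟧>0⇒≡true : ∀ {a} → 0 < ⟦ a ⟧ → a ≡ true
⟦⟧>0⇒≡true {true} _ = refl

⟦⟧≤1 : ∀ a → ⟦ a ⟧ ≤ 1
⟦⟧≤1 true  = ≤-refl
⟦⟧≤1 false = z≤n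

∧≡false⇒⟦⟧+⟦⟧≤1 : ∀ a b → a ∧ b ≡ false → ⟦ a ⟧ + ⟦ b ⟧ ≤ 1
∧≡false⇒⟦⟧+⟦⟧≤1 true  false _ = ≤-refl
∧≡false⇒⟦⟧+⟦⟧≤1 false b     _ = ⟦⟧≤1 b

Additive : ∀ {A : Set} → ((A → ℕ) → ℕ) → Set
Additive ∑ = ∀ f g → ∑ (λ x → f x + g x) ≡ ∑ f + ∑ g

additive⇒∑0≡0 : ∀ {A : Set} (∑ : (A → ℕ) → ℕ) → Additive ∑ → ∑ (λ _ → 0) ≡ 0
additive⇒∑0≡0 ∑ add =
  +-cancelˡ-≡ (∑ (λ _ → 0)) _ _ (trans (sym (add _ _)) (sym (+-identityʳ _)))

-- Finite sums are axiomatised rather than computed from an enumeration; ∑-comm is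
-- stated against any additive operator so that sums over different index types commute.
record Summation (A : Set) : Set₁ where
  field
    ∑           : (A → ℕ) → ℕ
    ∑-distrib-+ : Additive ∑
    ∑-mono      : ∀ {f g} → (∀ x → f x ≤ g x) → ∑ f ≤ ∑ g
    term≤∑      : ∀ f x → f x ≤ ∑ f
    ∑-witness   : ∀ f → 0 < ∑ f → ∃ λ x → 0 < f x
    ∑-comm      : ∀ {B : Set} (τ : (B → ℕ) → ℕ) → Additive τ →
                  ∀ (f : A → B → ℕ) → ∑ (λ a → τ (f a)) ≡ τ (λ b → ∑ (λ a → f a b))

  ∑-cong : ∀ {f g} → (∀ x → f x ≡ g x) → ∑ f ≡ ∑ g
  ∑-cong f≗g = ≤-antisym (∑-mono (≤-reflexive ∘ f≗g)) (∑-mono (≤-reflexive ∘ sym ∘ f≗g))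

  ∑-zero : ∑ (λ _ → 0) ≡ 0
  ∑-zero = additive⇒∑0≡0 ∑ ∑-distrib-+

  ∑-*ˡ : ∀ c f → ∑ (λ x → c * f x) ≡ c * ∑ f
  ∑-*ˡ zero    f = ∑-zero
  ∑-*ˡ (suc c) f = trans (∑-distrib-+ f _) (cong (∑ f +_) (∑-*ˡ c f))

  ∑-*ʳ : ∀ c f → ∑ (λ x → f x * c) ≡ ∑ f * c
  ∑-*ʳ c f = trans (∑-cong (λ x → *-comm (f x) c)) (trans (∑-*ˡ c f) (*-comm c (∑ f)))

  size : ℕ
  size = ∑ (λ _ → 1)

  ∑-const : ∀ c → ∑ (λ _ → c) ≡ size * c
  ∑-const c = trans (∑-cong (λ _ → sym (*-identityˡ c))) (∑-*ʳ c (λ _ → 1))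

  card : (A → Bool) → ℕ
  card p = ∑ (λ x → ⟦ p x ⟧)

  any : (A → Bool) → Bool
  any p = 1 ≤ᵇ card p

  any-witness : ∀ p → any p ≡ true → ∃ λ x → p x ≡ true
  any-witness p any≡true with ∑-witness _ (≤ᵇ⇒≤ 1 (card p) (Equivalence.from T-≡ any≡true))
  ... | x , 0<px = x , ⟦⟧>0⇒≡true 0<px

  any-intro : ∀ p x → p x ≡ true → any p ≡ true
  any-intro p x px≡true =
    Equivalence.to T-≡ (≤⇒≤ᵇ (subst (λ b → ⟦ b ⟧ ≤ card p) px≡true (term≤∑ _ x)))

  ⟦⟧≤⟦any⟧ : ∀ p x → ⟦ p x ⟧ ≤ ⟦ any p ⟧
  ⟦⟧≤⟦any⟧ p x with p x in px
  ... | true  = ≤-reflexive (cong ⟦_⟧ (sym (any-intro p x px)))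
  ... | false = z≤n

  any≡false : ∀ p → any p ≡ false → ∀ x → p x ≡ false
  any≡false p any≡false x with p x in px
  ... | true  = contradiction (trans (sym (any-intro p x px)) any≡false) λ ()
  ... | false = refl

open Summation

boolSummation : Summation Bool
boolSummation .∑ f = f true + f false
boolSummation .∑-distrib-+ f g = interchange (f true) (g true) (f false) (g false)
boolSummation .∑-mono f≤g = +-mono-≤ (f≤g true) (f≤g false)
boolSummation .term≤∑ f true  = m≤m+n (f true) (f false)
boolSummation .term≤∑ f false = m≤n+m (f false) (f true)
boolSummation .∑-witness f 0<∑f with f true in ftrue
... | suc _ = true , subst (0 <_) (sym ftrue) (s≤s z≤n)
... | zero  = false , 0<∑f
boolSummation .∑-comm τ τ-additive f = sym (τ-additive (f true) (f false))

vecSummation : ∀ {A : Set} → Summation A → ∀ m → Summation (Vec A m)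
vecSummation σ zero .∑ f = f []
vecSummation σ zero .∑-distrib-+ f g = refl
vecSummation σ zero .∑-mono f≤g = f≤g []
vecSummation σ zero .term≤∑ f [] = ≤-refl
vecSummation σ zero .∑-witness f 0<f[] = [] , 0<f[]
vecSummation σ zero .∑-comm τ τ-additive f = refl
vecSummation σ (suc m) .∑ f = ∑ σ (λ a → ∑ (vecSummation σ m) (λ xs → f (a ∷ xs)))
vecSummation σ (suc m) .∑-distrib-+ f g =
  trans (∑-cong σ (λ a → ∑-distrib-+ (vecSummation σ m) _ _)) (∑-distrib-+ σ _ _)
vecSummation σ (suc m) .∑-mono f≤g =
  ∑-mono σ (λ a → ∑-mono (vecSummation σ m) (λ xs → f≤g (a ∷ xs)))
vecSummation σ (suc m) .term≤∑ f (a ∷ xs) =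
  ≤-trans (term≤∑ (vecSummation σ m) _ xs) (term≤∑ σ _ a)
vecSummation σ (suc m) .∑-witness f 0<∑f with ∑-witness σ _ 0<∑f
... | a , 0<∑fa with ∑-witness (vecSummation σ m) _ 0<∑fa
...   | xs , 0<f = (a ∷ xs) , 0<f
vecSummation σ (suc m) .∑-comm τ τ-additive f =
  trans (∑-cong σ (λ a → ∑-comm (vecSummation σ m) τ τ-additive _)) (∑-comm σ τ τ-additive _)

finSummation : ∀ m → Summation (Fin m)
finSummation zero .∑ f = 0
finSummation zero .∑-distrib-+ f g = refl
finSummation zero .∑-mono f≤g = z≤n
finSummation zero .term≤∑ f ()
finSummation zero .∑-witness f ()
finSummation zero .∑-comm τ τ-additive f = sym (additive⇒∑0≡0 τ τ-additive)
finSummation (suc m) .∑ f = f zero + ∑ (finSummation m) (f ∘ suc)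
finSummation (suc m) .∑-distrib-+ f g =
  trans (cong (f zero + g zero +_) (∑-distrib-+ (finSummation m) (f ∘ suc) (g ∘ suc)))
        (interchange (f zero) (g zero) _ _)
finSummation (suc m) .∑-mono f≤g = +-mono-≤ (f≤g zero) (∑-mono (finSummation m) (f≤g ∘ suc))
finSummation (suc m) .term≤∑ f zero    = m≤m+n _ _
finSummation (suc m) .term≤∑ f (suc i) = ≤-trans (term≤∑ (finSummation m) (f ∘ suc) i) (m≤n+m _ _)
finSummation (suc m) .∑-witness f 0<∑f with f zero in f0
... | suc _ = zero , subst (0 <_) (sym f0) (s≤s z≤n)
... | zero with ∑-witness (finSummation m) (f ∘ suc) 0<∑f
...   | i , 0<fi = suc i , 0<fi
finSummation (suc m) .∑-comm τ τ-additive f =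
  trans (cong (τ (f zero) +_) (∑-comm (finSummation m) τ τ-additive (f ∘ suc))) (sym (τ-additive _ _))

∑-product : ∀ {X Y : Set} (σX : Summation X) (σY : Summation Y) f g →
            ∑ σX (λ x → ∑ σY (λ y → f x * g y)) ≡ ∑ σX f * ∑ σY g
∑-product σX σY f g = trans (∑-cong σX (λ x → ∑-*ˡ σY (f x) g)) (∑-*ʳ σX (∑ σY g) f)

fin-size : ∀ m → size (finSummation m) ≡ m
fin-size zero    = refl
fin-size (suc m) = cong suc (fin-size m)

∏ : ∀ m → (Fin m → ℕ) → ℕ
∏ zero    f = 1
∏ (suc m) f = f zero * ∏ m (f ∘ suc)

∏-mono : ∀ m {f g} → (∀ i → f i ≤ g i) → ∏ m f ≤ ∏ m g
∏-mono zero    f≤g = ≤-refl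
∏-mono (suc m) f≤g = *-mono-≤ (f≤g zero) (∏-mono m (f≤g ∘ suc))

∏-const : ∀ m c → ∏ m (λ _ → c) ≡ c ^ m
∏-const zero    c = refl
∏-const (suc m) c = cong (c *_) (∏-const m c)

∏-or-∑-not : ∀ m (P : Fin m → Bool) →
             1 ≤ ∏ m (⟦_⟧ ∘ P) + ∑ (finSummation m) (λ i → ⟦ not (P i) ⟧)
∏-or-∑-not zero    P = ≤-refl
∏-or-∑-not (suc m) P with P zero
... | true  = subst (λ x → 1 ≤ x + ∑ (finSummation m) (λ i → ⟦ not (P (suc i)) ⟧))
                    (sym (+-identityʳ (∏ m (⟦_⟧ ∘ P ∘ suc)))) (∏-or-∑-not m (P ∘ suc))
... | false = s≤s z≤n

PointMassOne : ∀ {A : Set} → Summation A → DecidableEquality A → Set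
PointMassOne σ _≟_ = ∀ x → ∑ σ (λ y → ⟦ does (x ≟ y) ⟧) ≡ 1

module _ {A : Set} (σ : Summation A) where

  vec-size : ∀ m → size (vecSummation σ m) ≡ size σ ^ m
  vec-size zero    = refl
  vec-size (suc m) = trans (∑-cong σ (λ _ → vec-size m)) (∑-const σ _)

  vec-∑-∏ : ∀ m (q : Fin m → A → ℕ) →
            ∑ (vecSummation σ m) (λ xs → ∏ m (λ i → q i (lookup xs i))) ≡ ∏ m (λ i → ∑ σ (q i))
  vec-∑-∏ zero    q = refl
  vec-∑-∏ (suc m) q = begin
      ∑ σ (λ a → ∑ σₘ (λ xs → q zero a * ∏ m (λ i → q (suc i) (lookup xs i))))
    ≡⟨ ∑-cong σ (λ a → ∑-*ˡ σₘ (q zero a) _) ⟩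
      ∑ σ (λ a → q zero a * ∑ σₘ (λ xs → ∏ m (λ i → q (suc i) (lookup xs i))))
    ≡⟨ ∑-cong σ (λ a → cong (q zero a *_) (vec-∑-∏ m (q ∘ suc))) ⟩
      ∑ σ (λ a → q zero a * ∏ m (λ i → ∑ σ (q (suc i))))
    ≡⟨ ∑-*ʳ σ _ (q zero) ⟩
      ∑ σ (q zero) * ∏ m (λ i → ∑ σ (q (suc i)))
    ∎
    where
    open ≡-Reasoning
    σₘ : Summation (Vec A m)
    σₘ = vecSummation σ m

  vec-pointMassOne : ∀ {_≟_} → PointMassOne σ _≟_ → ∀ m → PointMassOne (vecSummation σ m) (≡-dec _≟_)
  vec-pointMassOne             points zero    [] = refl
  vec-pointMassOne {_≟_ = _≟_} points (suc m) (x ∷ xs) = begin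
      ∑ σ (λ y → ∑ σₘ (λ ys → ⟦ does (x ≟ y) ∧ does (≡-dec _≟_ xs ys) ⟧))
    ≡⟨ ∑-cong σ (λ y → ∑-cong σₘ (λ ys → ⟦∧⟧ (does (x ≟ y)) _)) ⟩
      ∑ σ (λ y → ∑ σₘ (λ ys → ⟦ does (x ≟ y) ⟧ * ⟦ does (≡-dec _≟_ xs ys) ⟧))
    ≡⟨ ∑-cong σ (λ y → ∑-*ˡ σₘ ⟦ does (x ≟ y) ⟧ _) ⟩
      ∑ σ (λ y → ⟦ does (x ≟ y) ⟧ * ∑ σₘ (λ ys → ⟦ does (≡-dec _≟_ xs ys) ⟧))
    ≡⟨ ∑-*ʳ σ _ _ ⟩
      ∑ σ (λ y → ⟦ does (x ≟ y) ⟧) * ∑ σₘ (λ ys → ⟦ does (≡-dec _≟_ xs ys) ⟧)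
    ≡⟨ cong₂ _*_ (points x) (vec-pointMassOne points m xs) ⟩
      1
    ∎
    where
    open ≡-Reasoning
    σₘ : Summation (Vec A m)
    σₘ = vecSummation σ m

  vec-∑-zipWith-invariant : (_∙_ : A → A → A) → (∀ a f → ∑ σ (λ b → f (b ∙ a)) ≡ ∑ σ f) →
                            ∀ m (as : Vec A m) f →
                            ∑ (vecSummation σ m) (λ xs → f (zipWith _∙_ xs as)) ≡ ∑ (vecSummation σ m) f
  vec-∑-zipWith-invariant _∙_ invariant zero    []       f = refl
  vec-∑-zipWith-invariant _∙_ invariant (suc m) (a ∷ as) f =
    trans (∑-cong σ (λ b → vec-∑-zipWith-invariant _∙_ invariant m as (λ ys → f (b ∙ a ∷ ys))))
          (invariant a (λ b → ∑ (vecSummation σ m) (λ ys → f (b ∷ ys))))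

bits : ∀ n → Summation (BitStr n)
bits = vecSummation boolSummation

inputs : ∀ n m → Summation (Input n m)
inputs n = vecSummation (bits n)

bits-pointMassOne : ∀ n → PointMassOne (bits n) (≡-dec _≟B_)
bits-pointMassOne = vec-pointMassOne boolSummation bool-pointMassOne
  where
  bool-pointMassOne : PointMassOne boolSummation _≟B_
  bool-pointMassOne true  = refl
  bool-pointMassOne false = refl

bits-size : ∀ n → size (bits n) ≡ 2 ^ n
bits-size = vec-size boolSummation

bits-∑-⊕-invariant : ∀ n (s : BitStr n) f → ∑ (bits n) (λ v → f (v ⊕ s)) ≡ ∑ (bits n) f
bits-∑-⊕-invariant n = vec-∑-zipWith-invariant boolSummation _xor_ xor-invariant n
  where
  xor-invariant : ∀ a f → f (true xor a) + f (false xor a) ≡ f true + f false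
  xor-invariant true  f = +-comm (f false) (f true)
  xor-invariant false f = refl

⊕-cancelˡ : ∀ {n} (v s : BitStr n) → v ⊕ (v ⊕ s) ≡ s
⊕-cancelˡ []      []      = refl
⊕-cancelˡ (x ∷ v) (y ∷ s) =
  cong₂ _∷_ (trans (sym (xor-assoc x x y)) (cong (_xor y) (xor-same x))) (⊕-cancelˡ v s)

-- Heavy values

module Fibres {X V : Set} (σX : Summation X) (σV : Summation V)
              (_≟_ : DecidableEquality V) (points : PointMassOne σV _≟_) (key : X → V) where

  ∑-by-fibres : ∀ g → ∑ σX g ≡ ∑ σV (λ v → ∑ σX (λ x → g x * ⟦ does (key x ≟ v) ⟧))
  ∑-by-fibres g = begin
      ∑ σX g
    ≡⟨ ∑-cong σX (λ x → trans (sym (*-identityʳ (g x))) (cong (g x *_) (sym (points (key x))))) ⟩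
      ∑ σX (λ x → g x * ∑ σV (λ v → ⟦ does (key x ≟ v) ⟧))
    ≡⟨ ∑-cong σX (λ x → sym (∑-*ˡ σV (g x) _)) ⟩
      ∑ σX (λ x → ∑ σV (λ v → g x * ⟦ does (key x ≟ v) ⟧))
    ≡⟨ ∑-comm σX (∑ σV) (∑-distrib-+ σV) _ ⟩
      ∑ σV (λ v → ∑ σX (λ x → g x * ⟦ does (key x ≟ v) ⟧))
    ∎
    where open ≡-Reasoning

  module _ (θ : ℕ) (A : X → Bool) where

    fibre : V → ℕ
    fibre v = ∑ σX (λ x → ⟦ A x ⟧ * ⟦ does (key x ≟ v) ⟧)

    heavy : V → Bool
    heavy v = card σX A ≤ᵇ θ * fibre v

    heavy⇒card≤ : ∀ {v} → heavy v ≡ true → card σX A ≤ θ * fibre v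
    heavy⇒card≤ {v} heavy-v = ≤ᵇ⇒≤ _ _ (Equivalence.from T-≡ heavy-v)

    light-fibre≤card : ∀ v → θ * (⟦ not (heavy v) ⟧ * fibre v) ≤ card σX A
    light-fibre≤card v with heavy v in heavy-v
    ... | true  = subst (_≤ card σX A) (sym (*-zeroʳ θ)) z≤n
    ... | false = subst (_≤ card σX A) (cong (θ *_) (sym (*-identityˡ (fibre v)))) (≰⇒≥ light)
      where
      light : ¬ card σX A ≤ θ * fibre v
      light card≤ = subst T heavy-v (≤⇒≤ᵇ card≤)

    light-mass : θ * ∑ σX (λ x → ⟦ A x ⟧ * ⟦ not (heavy (key x)) ⟧) ≤ size σV * card σX A
    light-mass = begin
        θ * ∑ σX (λ x → ⟦ A x ⟧ * ⟦ not (heavy (key x)) ⟧)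
      ≡⟨ cong (θ *_) (∑-by-fibres _) ⟩
        θ * ∑ σV (λ v → ∑ σX (λ x → ⟦ A x ⟧ * ⟦ not (heavy (key x)) ⟧ * ⟦ does (key x ≟ v) ⟧))
      ≡⟨ cong (θ *_) (∑-cong σV restrict) ⟩
        θ * ∑ σV (λ v → ⟦ not (heavy v) ⟧ * fibre v)
      ≡⟨ ∑-*ˡ σV θ _ ⟨
        ∑ σV (λ v → θ * (⟦ not (heavy v) ⟧ * fibre v))
      ≤⟨ ∑-mono σV light-fibre≤card ⟩
        ∑ σV (λ _ → card σX A)
      ≡⟨ ∑-const σV _ ⟩
        size σV * card σX A
      ∎
      where
      open ≤-Reasoning
      restrict-term : ∀ v x → ⟦ A x ⟧ * ⟦ not (heavy (key x)) ⟧ * ⟦ does (key x ≟ v) ⟧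
                            ≡ ⟦ not (heavy v) ⟧ * (⟦ A x ⟧ * ⟦ does (key x ≟ v) ⟧)
      restrict-term v x with key x ≟ v
      ... | yes refl = rearrange ⟦ A x ⟧ ⟦ not (heavy (key x)) ⟧
        where
        rearrange : ∀ a b → a * b * 1 ≡ b * (a * 1)
        rearrange = solve-∀
      ... | no _ = vanish ⟦ A x ⟧ ⟦ not (heavy (key x)) ⟧ ⟦ not (heavy v) ⟧
        where
        vanish : ∀ a b c → a * b * 0 ≡ c * (a * 0)
        vanish = solve-∀
      restrict : ∀ v → ∑ σX (λ x → ⟦ A x ⟧ * ⟦ not (heavy (key x)) ⟧ * ⟦ does (key x ≟ v) ⟧)
                       ≡ ⟦ not (heavy v) ⟧ * fibre v
      restrict v = trans (∑-cong σX (restrict-term v))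
                         (∑-*ˡ σX ⟦ not (heavy v) ⟧ (λ x → ⟦ A x ⟧ * ⟦ does (key x ≟ v) ⟧))

module HeavyCoordinates {V : Set} (σ : Summation V) (_≟_ : DecidableEquality V)
                        (points : PointMassOne σ _≟_) {m : ℕ} (A : Vec V m → Bool) where

  private
    N : ℕ
    N = size σ

    σX : Summation (Vec V m)
    σX = vecSummation σ m

    σI : Summation (Fin m)
    σI = finSummation m

  heavyAt : Fin m → V → Bool
  heavyAt i = Fibres.heavy σX σ _≟_ points (λ xs → lookup xs i) (N * N) A

  fibreAt : Fin m → V → ℕ
  fibreAt i = Fibres.fibre σX σ _≟_ points (λ xs → lookup xs i) (N * N) A

  heavyAt⇒card≤ : ∀ {i v} → heavyAt i v ≡ true → card σX A ≤ N * N * fibreAt i v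
  heavyAt⇒card≤ {i} = Fibres.heavy⇒card≤ σX σ _≟_ points (λ xs → lookup xs i) (N * N) A

  lightAt : Fin m → ℕ
  lightAt i = ∑ σX (λ xs → ⟦ A xs ⟧ * ⟦ not (heavyAt i (lookup xs i)) ⟧)

  card≤∏heavy+∑light : card σX A ≤ ∏ m (λ i → card σ (heavyAt i)) + ∑ σI lightAt
  card≤∏heavy+∑light = begin
      card σX A
    ≤⟨ ∑-mono σX split ⟩
      ∑ σX (λ xs → ∏ m (λ i → ⟦ heavyAt i (lookup xs i) ⟧)
                 + ∑ σI (λ i → ⟦ A xs ⟧ * ⟦ not (heavyAt i (lookup xs i)) ⟧))
    ≡⟨ ∑-distrib-+ σX _ _ ⟩
      ∑ σX (λ xs → ∏ m (λ i → ⟦ heavyAt i (lookup xs i) ⟧))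
        + ∑ σX (λ xs → ∑ σI (λ i → ⟦ A xs ⟧ * ⟦ not (heavyAt i (lookup xs i)) ⟧))
    ≡⟨ cong₂ _+_ (vec-∑-∏ σ m (λ i v → ⟦ heavyAt i v ⟧)) (∑-comm σX (∑ σI) (∑-distrib-+ σI) _) ⟩
      ∏ m (λ i → card σ (heavyAt i)) + ∑ σI lightAt
    ∎
    where
    open ≤-Reasoning
    split : ∀ xs → ⟦ A xs ⟧ ≤ ∏ m (λ i → ⟦ heavyAt i (lookup xs i) ⟧)
                            + ∑ σI (λ i → ⟦ A xs ⟧ * ⟦ not (heavyAt i (lookup xs i)) ⟧)
    split xs with A xs
    ... | false = z≤n
    ... | true  = subst (λ ℓ → 1 ≤ ∏ m (λ i → ⟦ heavyAt i (lookup xs i) ⟧) + ℓ)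
                        (∑-cong σI (λ i → sym (*-identityˡ _)))
                        (∏-or-∑-not m (λ i → heavyAt i (lookup xs i)))

  ∑light≤ : N * N * ∑ σI lightAt ≤ m * (N * card σX A)
  ∑light≤ = begin
      N * N * ∑ σI lightAt          ≡⟨ ∑-*ˡ σI (N * N) lightAt ⟨
      ∑ σI (λ i → N * N * lightAt i) ≤⟨ ∑-mono σI lightAt≤ ⟩
      ∑ σI (λ _ → N * card σX A)   ≡⟨ ∑-const σI _ ⟩
      size σI * (N * card σX A)    ≡⟨ cong (_* (N * card σX A)) (fin-size m) ⟩
      m * (N * card σX A)          ∎
    where
    open ≤-Reasoning
    lightAt≤ : ∀ i → N * N * lightAt i ≤ N * card σX A
    lightAt≤ i = Fibres.light-mass σX σ _≟_ points (λ xs → lookup xs i) (N * N) A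

  card≤2*∏heavy : 0 < N → 2 * m ≤ N → card σX A ≤ 2 * ∏ m (λ i → card σ (heavyAt i))
  card≤2*∏heavy 0<N 2m≤N = ≤-halve N {m = m} {{>-nonZero 0<N}} 2m≤N card≤∏heavy+∑light ∑light≤

-- Rectangles

unsolved : ∀ {n m} → Input n m → Input n m → BitStr n → Bool
unsolved X Y s = not ⌊ isSolution? X Y s ⌋

unsolved-if-hit : ∀ {n m} (X Y : Input n m) s i j → lookup X i ⊕ lookup Y j ≡ s → unsolved X Y s ≡ true
unsolved-if-hit X Y s i j hit =
  cong not (trans (isYes≗does (isSolution? X Y s)) (dec-false (isSolution? X Y s) (λ solution → solution i j (sym hit))))

module Rectangle (n m : ℕ) where

  N : ℕ
  N = size (bits n)

  Q : ℕ
  Q = N * N * (N * N)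

  0<N : 0 < N
  0<N = subst (0 <_) (sym (bits-size n)) (m^n>0 2 n)

  2⁵ⁿ≡N*Q : 2 ^ (5 * n) ≡ N * Q
  2⁵ⁿ≡N*Q = begin
    2 ^ (5 * n)   ≡⟨ cong (2 ^_) (*-comm 5 n) ⟩
    2 ^ (n * 5)   ≡⟨ ^-*-assoc 2 n 5 ⟨
    (2 ^ n) ^ 5   ≡⟨ cong (_^ 5) (bits-size n) ⟨
    N ^ 5         ≡⟨ fifth N ⟩
    N * Q         ∎
    where
    open ≡-Reasoning
    fifth : ∀ x → x * (x * (x * (x * (x * 1)))) ≡ x * (x * x * (x * x))
    fifth = solve-∀

  private
    σI : Summation (Input n m)
    σI = inputs n m

    _≟_ : DecidableEquality (BitStr n)
    _≟_ = ≡-dec _≟B_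

  open HeavyCoordinates (bits n) _≟_ (bits-pointMassOne n)
    using (heavyAt; heavyAt⇒card≤; card≤2*∏heavy)

  #unsolved : (A B : Input n m → Bool) → BitStr n → ℕ
  #unsolved A B s = ∑ σI (λ X → ∑ σI (λ Y → ⟦ A X ⟧ * ⟦ B Y ⟧ * ⟦ unsolved X Y s ⟧))

  module _ (A B : Input n m → Bool) (s : BitStr n) where

    heavy-pair⇒unsolved : ∀ i j v → heavyAt A i v ≡ true → heavyAt B j (v ⊕ s) ≡ true →
                          card σI A * card σI B ≤ Q * #unsolved A B s
    heavy-pair⇒unsolved i j v A-heavy B-heavy = begin
        card σI A * card σI B
      ≤⟨ *-mono-≤ (heavyAt⇒card≤ A A-heavy) (heavyAt⇒card≤ B B-heavy) ⟩
        N * N * fA * (N * N * fB)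
      ≡⟨ rearrange (N * N) fA fB ⟩
        Q * (fA * fB)
      ≡⟨ cong (Q *_) (∑-product σI σI _ _) ⟨
        Q * ∑ σI (λ X → ∑ σI (λ Y → (⟦ A X ⟧ * δ (lookup X i) v) * (⟦ B Y ⟧ * δ (lookup Y j) (v ⊕ s))))
      ≤⟨ *-monoʳ-≤ Q (∑-mono σI (λ X → ∑-mono σI (λ Y → hits X Y))) ⟩
        Q * #unsolved A B s
      ∎
      where
      open ≤-Reasoning
      δ : BitStr n → BitStr n → ℕ
      δ u w = ⟦ does (u ≟ w) ⟧
      fA fB : ℕ
      fA = ∑ σI (λ X → ⟦ A X ⟧ * δ (lookup X i) v)
      fB = ∑ σI (λ Y → ⟦ B Y ⟧ * δ (lookup Y j) (v ⊕ s))
      rearrange : ∀ q a b → q * a * (q * b) ≡ q * q * (a * b)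
      rearrange = solve-∀
      hits : ∀ X Y → (⟦ A X ⟧ * δ (lookup X i) v) * (⟦ B Y ⟧ * δ (lookup Y j) (v ⊕ s))
                     ≤ ⟦ A X ⟧ * ⟦ B Y ⟧ * ⟦ unsolved X Y s ⟧
      hits X Y with lookup X i ≟ v | lookup Y j ≟ (v ⊕ s)
      ... | yes Xi≡v | yes Yj≡v⊕s =
        ≤-reflexive (trans (ones ⟦ A X ⟧ ⟦ B Y ⟧)
                           (cong (λ b → ⟦ A X ⟧ * ⟦ B Y ⟧ * ⟦ b ⟧) (sym (unsolved-if-hit X Y s i j hit))))
        where
        hit : lookup X i ⊕ lookup Y j ≡ s
        hit = trans (cong₂ _⊕_ Xi≡v Yj≡v⊕s) (⊕-cancelˡ v s)
        ones : ∀ a b → a * 1 * (b * 1) ≡ a * b * 1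
        ones = solve-∀
      ... | yes _ | no _ = ≤-trans (≤-reflexive (zero₂ ⟦ A X ⟧ ⟦ B Y ⟧)) z≤n
        where
        zero₂ : ∀ a b → a * 1 * (b * 0) ≡ 0
        zero₂ = solve-∀
      ... | no _ | _ = ≤-trans (≤-reflexive (zero₁ ⟦ A X ⟧ ⟦ B Y ⟧ _)) z≤n
        where
        zero₁ : ∀ a b c → a * 0 * (b * c) ≡ 0
        zero₁ = solve-∀

    anyHeavyA anyHeavyB : BitStr n → Bool
    anyHeavyA v = any (finSummation m) (λ i → heavyAt A i v)
    anyHeavyB v = any (finSummation m) (λ j → heavyAt B j (v ⊕ s))

    disjoint⇒small : 2 * m ≤ N → (∀ v → anyHeavyA v ∧ anyHeavyB v ≡ false) →
                     4 ^ m * (card σI A * card σI B) ≤ 4 * (N * N) ^ m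
    disjoint⇒small 2m≤N disjoint = begin
        4 ^ m * (card σI A * card σI B)
      ≤⟨ *-monoʳ-≤ (4 ^ m) (*-mono-≤ (card≤2*∏heavy A 0<N 2m≤N) (card≤2*∏heavy B 0<N 2m≤N)) ⟩
        4 ^ m * (2 * ∏ m #heavyA * (2 * ∏ m #heavyB))
      ≤⟨ *-monoʳ-≤ (4 ^ m) (*-mono-≤ (*-monoʳ-≤ 2 ∏A≤) (*-monoʳ-≤ 2 ∏B≤)) ⟩
        4 ^ m * (2 * u ^ m * (2 * w ^ m))
      ≡⟨ regroup ⟩
        4 * (4 * (u * w)) ^ m
      ≤⟨ *-monoʳ-≤ 4 (^-monoˡ-≤ m (≤-trans (4xy≤[x+y]² u w) (*-mono-≤ u+w≤N u+w≤N))) ⟩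
        4 * (N * N) ^ m
      ∎
      where
      open ≤-Reasoning
      u w : ℕ
      u = card (bits n) anyHeavyA
      w = card (bits n) anyHeavyB
      #heavyA #heavyB : Fin m → ℕ
      #heavyA i = card (bits n) (heavyAt A i)
      #heavyB j = card (bits n) (heavyAt B j)
      u+w≤N : u + w ≤ N
      u+w≤N = begin
        u + w                              ≡⟨ ∑-distrib-+ (bits n) _ _ ⟨
        ∑ (bits n) (λ v → ⟦ anyHeavyA v ⟧ + ⟦ anyHeavyB v ⟧)
                                           ≤⟨ ∑-mono (bits n) (λ v → ∧≡false⇒⟦⟧+⟦⟧≤1 (anyHeavyA v) _ (disjoint v)) ⟩
        N                                  ∎
      #heavyA≤u : ∀ i → #heavyA i ≤ u
      #heavyA≤u i = ∑-mono (bits n) (λ v → ⟦⟧≤⟦any⟧ (finSummation m) (λ i → heavyAt A i v) i)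
      #heavyB≤w : ∀ j → #heavyB j ≤ w
      #heavyB≤w j = ≤-trans (≤-reflexive (sym (bits-∑-⊕-invariant n s _)))
                            (∑-mono (bits n) (λ v → ⟦⟧≤⟦any⟧ (finSummation m) (λ j → heavyAt B j (v ⊕ s)) j))
      ∏A≤ : ∏ m #heavyA ≤ u ^ m
      ∏A≤ = subst (∏ m #heavyA ≤_) (∏-const m u) (∏-mono m #heavyA≤u)
      ∏B≤ : ∏ m #heavyB ≤ w ^ m
      ∏B≤ = subst (∏ m #heavyB ≤_) (∏-const m w) (∏-mono m #heavyB≤w)
      regroup : 4 ^ m * (2 * u ^ m * (2 * w ^ m)) ≡ 4 * (4 * (u * w)) ^ m
      regroup = begin-equality
        4 ^ m * (2 * u ^ m * (2 * w ^ m))  ≡⟨ shuffle (4 ^ m) (u ^ m) (w ^ m) ⟩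
        4 * (4 ^ m * (u ^ m * w ^ m))     ≡⟨ cong (λ x → 4 * (4 ^ m * x)) (^-distrib-* u w m) ⟨
        4 * (4 ^ m * (u * w) ^ m)         ≡⟨ cong (4 *_) (^-distrib-* 4 (u * w) m) ⟨
        4 * (4 * (u * w)) ^ m             ∎
        where
        shuffle : ∀ f a b → f * (2 * a * (2 * b)) ≡ 4 * (f * (a * b))
        shuffle = solve-∀

    rectangle-bound : 2 * m ≤ N →
                      4 ^ m * (card σI A * card σI B) ≤ 4 ^ m * Q * #unsolved A B s + 4 * (N * N) ^ m
    rectangle-bound 2m≤N with any (bits n) (λ v → anyHeavyA v ∧ anyHeavyB v) in heavy-overlap
    ... | false = ≤-trans (disjoint⇒small 2m≤N (any≡false (bits n) _ heavy-overlap))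
                          (m≤n+m _ (4 ^ m * Q * #unsolved A B s))
    ... | true with any-witness (bits n) _ heavy-overlap
    ...   | v , heavyAB with any-witness (finSummation m) _ (∧-conicalˡ _ _ heavyAB)
                           | any-witness (finSummation m) _ (∧-conicalʳ _ _ heavyAB)
    ...     | i , A-heavy-i | j , B-heavy-j = begin
        4 ^ m * (card σI A * card σI B)  ≤⟨ *-monoʳ-≤ (4 ^ m) (heavy-pair⇒unsolved i j v A-heavy-i B-heavy-j) ⟩
        4 ^ m * (Q * #unsolved A B s)    ≡⟨ *-assoc (4 ^ m) Q _ ⟨
        4 ^ m * Q * #unsolved A B s      ≤⟨ m≤m+n _ _ ⟩
        4 ^ m * Q * #unsolved A B s + 4 * (N * N) ^ m ∎
      where open ≤-Reasoning

-- Protocol trees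

module ProtocolMass {X Y O : Set} (σX : Summation X) (σY : Summation Y) where

  mass : (X → Y → O → ℕ) → (X → Bool) → (Y → Bool) → Protocol X Y O → ℕ
  mass h A B P = ∑ σX (λ x → ∑ σY (λ y → ⟦ A x ⟧ * ⟦ B y ⟧ * h x y (run P x y)))

  mass-leaf : ∀ (h : O → ℕ) A B o → mass (λ _ _ → h) A B (leaf o) ≡ h o * (card σX A * card σY B)
  mass-leaf h A B o = begin
      ∑ σX (λ x → ∑ σY (λ y → ⟦ A x ⟧ * ⟦ B y ⟧ * h o))
    ≡⟨ ∑-cong σX (λ x → ∑-cong σY (λ y → *-comm (⟦ A x ⟧ * ⟦ B y ⟧) (h o))) ⟩
      ∑ σX (λ x → ∑ σY (λ y → h o * (⟦ A x ⟧ * ⟦ B y ⟧)))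
    ≡⟨ trans (∑-cong σX (λ x → ∑-*ˡ σY (h o) _)) (∑-*ˡ σX (h o) _) ⟩
      h o * ∑ σX (λ x → ∑ σY (λ y → ⟦ A x ⟧ * ⟦ B y ⟧))
    ≡⟨ cong (h o *_) (∑-product σX σY _ _) ⟩
      h o * (card σX A * card σY B)
    ∎
    where open ≡-Reasoning

  mass-alice : ∀ h A B f l r → mass h A B (alice f l r) ≡
               mass h (λ x → A x ∧ f x) B l + mass h (λ x → A x ∧ not (f x)) B r
  mass-alice h A B f l r =
    trans (∑-cong σX (λ x → trans (∑-cong σY (split x)) (∑-distrib-+ σY _ _))) (∑-distrib-+ σX _ _)
    where
    split : ∀ x y → ⟦ A x ⟧ * ⟦ B y ⟧ * h x y (run (alice f l r) x y)
                  ≡ ⟦ A x ∧ f x ⟧ * ⟦ B y ⟧ * h x y (run l x y)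
                    + ⟦ A x ∧ not (f x) ⟧ * ⟦ B y ⟧ * h x y (run r x y)
    split x y with A x | f x
    ... | true  | true  = sym (+-identityʳ _)
    ... | true  | false = refl
    ... | false | _     = refl

  mass-bob : ∀ h A B g l r → mass h A B (bob g l r) ≡
             mass h A (λ y → B y ∧ g y) l + mass h A (λ y → B y ∧ not (g y)) r
  mass-bob h A B g l r =
    trans (∑-cong σX (λ x → trans (∑-cong σY (split x)) (∑-distrib-+ σY _ _))) (∑-distrib-+ σX _ _)
    where
    split : ∀ x y → ⟦ A x ⟧ * ⟦ B y ⟧ * h x y (run (bob g l r) x y)
                  ≡ ⟦ A x ⟧ * ⟦ B y ∧ g y ⟧ * h x y (run l x y)
                    + ⟦ A x ⟧ * ⟦ B y ∧ not (g y) ⟧ * h x y (run r x y)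
    split x y with A x | B y | g y
    ... | true  | true  | true  = sym (+-identityʳ _)
    ... | true  | true  | false = refl
    ... | true  | false | _     = refl
    ... | false | _     | true  = refl
    ... | false | _     | false = refl

  mass-bound : ∀ (a b K : ℕ) (g h : X → Y → O → ℕ) →
               (∀ A B o → a * mass g A B (leaf o) ≤ b * mass h A B (leaf o) + K) →
               ∀ P A B → a * mass g A B P ≤ b * mass h A B P + 2 ^ depth P * K
  mass-bound a b K g h leaf-bound (leaf o) A B =
    subst (λ x → a * mass g A B (leaf o) ≤ b * mass h A B (leaf o) + x)
          (sym (+-identityʳ K)) (leaf-bound A B o)
  mass-bound a b K g h leaf-bound (alice f l r) A B
    rewrite mass-alice g A B f l r | mass-alice h A B f l r =
    merge-bounds a b (depth l) (depth r)
      (mass-bound a b K g h leaf-bound l (λ x → A x ∧ f x) B)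
      (mass-bound a b K g h leaf-bound r (λ x → A x ∧ not (f x)) B)
  mass-bound a b K g h leaf-bound (bob g′ l r) A B
    rewrite mass-bob g A B g′ l r | mass-bob h A B g′ l r =
    merge-bounds a b (depth l) (depth r)
      (mass-bound a b K g h leaf-bound l A (λ y → B y ∧ g′ y))
      (mass-bound a b K g h leaf-bound r A (λ y → B y ∧ not (g′ y)))

-- The lower bound

wrongOut : ∀ {n m} → Input n m → Input n m → Maybe (BitStr n) → Bool
wrongOut X Y (just s) = unsolved X Y s
wrongOut X Y nothing  = false

⟦notBot⟧≡⟦good⟧+⟦wrong⟧ : ∀ {n m} (X Y : Input n m) o →
                          ⟦ notBot o ⟧ ≡ ⟦ goodOut X Y o ⟧ + ⟦ wrongOut X Y o ⟧
⟦notBot⟧≡⟦good⟧+⟦wrong⟧ X Y nothing  = refl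
⟦notBot⟧≡⟦good⟧+⟦wrong⟧ X Y (just s) = excluded-middle ⌊ isSolution? X Y s ⌋
  where
  excluded-middle : ∀ b → 1 ≡ ⟦ b ⟧ + ⟦ not b ⟧
  excluded-middle true  = refl
  excluded-middle false = refl

count≡card : ∀ k p → count k p ≡ card (bits k) p
count≡card zero    p with p []
... | true  = refl
... | false = refl
count≡card (suc k) p = cong₂ _+_ (count≡card k _) (count≡card k _)

module LowerBound {n m k c : ℕ} (Π : PostProtocol n m k)
                  (shallow : ∀ r → depth (Π r) ≤ c) (solves : SolvesWithError Π (5 * n)) where

  open Rectangle n m
  open ProtocolMass {O = Maybe (BitStr n)} (inputs n m) (inputs n m)

  private
    σI : Summation (Input n m)
    σI = inputs n m

    σR : Summation (BitStr k)
    σR = bits k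

  nonBot′ wrong′ : Input n m → Input n m → Maybe (BitStr n) → ℕ
  nonBot′ X Y o = ⟦ notBot o ⟧
  wrong′  X Y o = ⟦ wrongOut X Y o ⟧

  total : (Input n m → Input n m → Maybe (BitStr n) → ℕ) → ℕ
  total h = ∑ σR (λ r → mass h (λ _ → true) (λ _ → true) (Π r))

  total-by-input : ∀ h → total h ≡ ∑ σI (λ X → ∑ σI (λ Y → ∑ σR (λ r → h X Y (run (Π r) X Y))))
  total-by-input h = sym (begin
      ∑ σI (λ X → ∑ σI (λ Y → ∑ σR (λ r → h X Y (run (Π r) X Y))))
    ≡⟨ ∑-cong σI (λ X → ∑-comm σI (∑ σR) (∑-distrib-+ σR) _) ⟩
      ∑ σI (λ X → ∑ σR (λ r → ∑ σI (λ Y → h X Y (run (Π r) X Y))))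
    ≡⟨ ∑-comm σI (∑ σR) (∑-distrib-+ σR) _ ⟩
      ∑ σR (λ r → ∑ σI (λ X → ∑ σI (λ Y → h X Y (run (Π r) X Y))))
    ≡⟨ ∑-cong σR (λ r → ∑-cong σI (λ X → ∑-cong σI (λ Y → sym (*-identityˡ _)))) ⟩
      total h
    ∎)
    where open ≡-Reasoning

  #nonBot #good #wrong : Input n m → Input n m → ℕ
  #nonBot X Y = ∑ σR (λ r → ⟦ notBot (run (Π r) X Y) ⟧)
  #good   X Y = ∑ σR (λ r → ⟦ goodOut X Y (run (Π r) X Y) ⟧)
  #wrong  X Y = ∑ σR (λ r → ⟦ wrongOut X Y (run (Π r) X Y) ⟧)

  wrong-fraction : ∀ X Y → 2 ^ (5 * n) * #wrong X Y ≤ #nonBot X Y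
  wrong-fraction X Y =
    subst (2 ^ (5 * n) * #wrong X Y ≤_) (sym nonBot≡good+wrong)
          (postselection-error (m^n>0 2 (5 * n)) error-bound)
    where
    nonBot≡good+wrong : #nonBot X Y ≡ #good X Y + #wrong X Y
    nonBot≡good+wrong =
      trans (∑-cong σR (λ r → ⟦notBot⟧≡⟦good⟧+⟦wrong⟧ X Y (run (Π r) X Y))) (∑-distrib-+ σR _ _)
    error-bound : (2 ^ (5 * n) ∸ 1) * (#good X Y + #wrong X Y) ≤ 2 ^ (5 * n) * #good X Y
    error-bound = subst₂ (λ a b → (2 ^ (5 * n) ∸ 1) * a ≤ 2 ^ (5 * n) * b)
                         (trans (count≡card k _) nonBot≡good+wrong) (count≡card k _) (proj₂ (solves X Y))

  wrong-total : 2 ^ (5 * n) * total wrong′ ≤ total nonBot′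
  wrong-total = begin
      2 ^ (5 * n) * total wrong′
    ≡⟨ cong (2 ^ (5 * n) *_) (total-by-input wrong′) ⟩
      2 ^ (5 * n) * ∑ σI (λ X → ∑ σI (#wrong X))
    ≡⟨ trans (∑-cong σI (λ X → ∑-*ˡ σI (2 ^ (5 * n)) (#wrong X))) (∑-*ˡ σI (2 ^ (5 * n)) _) ⟨
      ∑ σI (λ X → ∑ σI (λ Y → 2 ^ (5 * n) * #wrong X Y))
    ≤⟨ ∑-mono σI (λ X → ∑-mono σI (wrong-fraction X)) ⟩
      ∑ σI (λ X → ∑ σI (#nonBot X))
    ≡⟨ total-by-input nonBot′ ⟨
      total nonBot′
    ∎
    where open ≤-Reasoning

  inputs²≤total : size σI * size σI ≤ total nonBot′
  inputs²≤total = begin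
      size σI * size σI
    ≡⟨ ∑-product σI σI (λ _ → 1) (λ _ → 1) ⟨
      ∑ σI (λ X → ∑ σI (λ Y → 1))
    ≤⟨ ∑-mono σI (λ X → ∑-mono σI (λ Y → subst (0 <_) (count≡card k _) (proj₁ (solves X Y)))) ⟩
      ∑ σI (λ X → ∑ σI (#nonBot X))
    ≡⟨ total-by-input nonBot′ ⟨
      total nonBot′
    ∎
    where open ≤-Reasoning

  K : ℕ
  K = 4 * (N * N) ^ m

  leaf-bound : 2 * m ≤ N → ∀ A B o →
               4 ^ m * mass nonBot′ A B (leaf o) ≤ 4 ^ m * Q * mass wrong′ A B (leaf o) + K
  leaf-bound 2m≤N A B nothing =
    ≤-trans (≤-reflexive (trans (cong (4 ^ m *_) (mass-leaf (⟦_⟧ ∘ notBot) A B nothing)) (*-zeroʳ (4 ^ m)))) z≤n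
  leaf-bound 2m≤N A B (just s) =
    subst (λ x → 4 ^ m * x ≤ 4 ^ m * Q * #unsolved A B s + K)
          (sym (trans (mass-leaf (⟦_⟧ ∘ notBot) A B (just s)) (*-identityˡ _)))
          (rectangle-bound A B s 2m≤N)

  protocol-total : 2 * m ≤ N → 4 ^ m * total nonBot′ ≤ 4 ^ m * Q * total wrong′ + 2 ^ k * (2 ^ c * K)
  protocol-total 2m≤N = begin
      4 ^ m * total nonBot′
    ≡⟨ ∑-*ˡ σR (4 ^ m) _ ⟨
      ∑ σR (λ r → 4 ^ m * mass nonBot′ ⊤ ⊤ (Π r))
    ≤⟨ ∑-mono σR tree-bound ⟩
      ∑ σR (λ r → 4 ^ m * Q * mass wrong′ ⊤ ⊤ (Π r) + 2 ^ c * K)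
    ≡⟨ ∑-distrib-+ σR _ _ ⟩
      ∑ σR (λ r → 4 ^ m * Q * mass wrong′ ⊤ ⊤ (Π r)) + ∑ σR (λ _ → 2 ^ c * K)
    ≡⟨ cong₂ _+_ (∑-*ˡ σR (4 ^ m * Q) _) (trans (∑-const σR _) (cong (_* (2 ^ c * K)) (bits-size k))) ⟩
      4 ^ m * Q * total wrong′ + 2 ^ k * (2 ^ c * K)
    ∎
    where
    open ≤-Reasoning
    ⊤ : Input n m → Bool
    ⊤ _ = true
    tree-bound : ∀ r → 4 ^ m * mass nonBot′ ⊤ ⊤ (Π r) ≤ 4 ^ m * Q * mass wrong′ ⊤ ⊤ (Π r) + 2 ^ c * K
    tree-bound r = ≤-trans (mass-bound (4 ^ m) (4 ^ m * Q) K nonBot′ wrong′ (leaf-bound 2m≤N) (Π r) ⊤ ⊤)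
                           (+-monoʳ-≤ _ (*-monoˡ-≤ K (^-monoʳ-≤ 2 (shallow r))))

  lower-bound : 1 ≤ n → 2 * m ≤ 2 ^ n → 2 * m ≤ 3 + (k + c)
  lower-bound 1≤n 2m≤2ⁿ =
    2^m≤2^n⇒m≤n (subst (_≤ 2 ^ (3 + (k + c))) (^-*-assoc 2 2 m)
      (*-cancelʳ-≤ (4 ^ m) (2 ^ (3 + (k + c))) I² {{>-nonZero 0<I²}} (begin
        4 ^ m * I²                            ≤⟨ *-monoʳ-≤ (4 ^ m) inputs²≤total ⟩
        4 ^ m * total nonBot′                 ≤⟨ ≤-absorb N 2≤N N*wrong≤nonBot (protocol-total 2m≤N) ⟩
        2 * (2 ^ k * (2 ^ c * K))             ≡⟨ cong (λ x → 2 * (2 ^ k * (2 ^ c * x))) K≡4I² ⟩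
        2 * (2 ^ k * (2 ^ c * (4 * I²)))      ≡⟨ regroup (2 ^ k) (2 ^ c) I² ⟩
        2 * (2 * (2 * (2 ^ k * 2 ^ c))) * I²  ≡⟨ cong (λ x → 2 * (2 * (2 * x)) * I²) (^-distribˡ-+-* 2 k c) ⟨
        2 ^ (3 + (k + c)) * I²                ∎)))
    where
    open ≤-Reasoning
    2m≤N : 2 * m ≤ N
    2m≤N = subst (2 * m ≤_) (sym (bits-size n)) 2m≤2ⁿ
    2≤N : 2 ≤ N
    2≤N = subst (2 ≤_) (sym (bits-size n)) (^-monoʳ-≤ 2 1≤n)
    I² : ℕ
    I² = size σI * size σI
    0<I² : 0 < I²
    0<I² = *-mono-≤ 0<size 0<size
      where
      0<size : 0 < size σI
      0<size = subst (0 <_) (sym (vec-size (bits n) m)) (m^n>0 N {{>-nonZero 0<N}} m)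
    K≡4I² : K ≡ 4 * I²
    K≡4I² = cong (4 *_) (trans (^-distrib-* N N m) (sym (cong₂ _*_ (vec-size (bits n) m) (vec-size (bits n) m))))
    N*wrong≤nonBot : N * (4 ^ m * Q * total wrong′) ≤ 4 ^ m * total nonBot′
    N*wrong≤nonBot = begin
      N * (4 ^ m * Q * total wrong′)        ≡⟨ shuffle N (4 ^ m) Q (total wrong′) ⟩
      4 ^ m * (N * Q * total wrong′)        ≡⟨ cong (λ x → 4 ^ m * (x * total wrong′)) 2⁵ⁿ≡N*Q ⟨
      4 ^ m * (2 ^ (5 * n) * total wrong′)  ≤⟨ *-monoʳ-≤ (4 ^ m) wrong-total ⟩
      4 ^ m * total nonBot′                 ∎
      where
      shuffle : ∀ x f q w → x * (f * q * w) ≡ f * (x * q * w)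
      shuffle = solve-∀
    regroup : ∀ a b t → 2 * (a * (b * (4 * t))) ≡ 2 * (2 * (2 * (a * b))) * t
    regroup = solve-∀

theorem1p4 : Σ ℕ λ a → Σ ℕ λ b → (0 < a) × (0 < b) ×
    (∀ (n m : ℕ) → 1 ≤ n → 20 * n ≤ m → m * m < 2 ^ n →
     ∀ (k c : ℕ) (Π : PostProtocol n m k) →
     (∀ r → depth (Π r) ≤ c) →
     SolvesWithError Π (5 * n) →
     a * m ≤ b * (k + c))
theorem1p4 = 1 , 1 , ≤-refl , ≤-refl , m≤k+c
  where
  m≤k+c : ∀ (n m : ℕ) → 1 ≤ n → 20 * n ≤ m → m * m < 2 ^ n →
          ∀ (k c : ℕ) (Π : PostProtocol n m k) → (∀ r → depth (Π r) ≤ c) →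
          SolvesWithError Π (5 * n) → 1 * m ≤ 1 * (k + c)
  m≤k+c n m 1≤n 20n≤m m²<2ⁿ k c Π shallow solves =
    subst₂ _≤_ (sym (*-identityˡ m)) (sym (*-identityˡ (k + c))) (+-cancelˡ-≤ 3 m (k + c) (begin
      3 + m        ≤⟨ +-monoˡ-≤ m 3≤m ⟩
      m + m        ≡⟨ cong (m +_) (+-identityʳ m) ⟨
      2 * m        ≤⟨ LowerBound.lower-bound Π shallow solves 1≤n 2m≤2ⁿ ⟩
      3 + (k + c)  ∎))
    where
    open ≤-Reasoning
    20≤m : 20 ≤ m
    20≤m = ≤-trans (*-monoʳ-≤ 20 1≤n) 20n≤m
    3≤m : 3 ≤ m
    3≤m = ≤-trans (s≤s (s≤s (s≤s z≤n))) 20≤m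
    2m≤2ⁿ : 2 * m ≤ 2 ^ n
    2m≤2ⁿ = ≤-trans (*-monoˡ-≤ m (≤-trans (s≤s (s≤s z≤n)) 20≤m)) (<⇒≤ m²<2ⁿ)
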